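{- Let $n\geq 1$ and $p\geq1$. If $H$ is a maximal hypercube of dimension $p$ in the Lucas cube $\Lambda_n$, then its bottom vertex is $b(H)=0^n$ and its top vertex is $t(H)=0^{l_0}10^{l_1}\dots 10^{l_i}\dots10^{l_{p}}$ where $\sum_{i=0}^p l_i=n-p$, $0\leq l_0\leq 2$, $0\leq l_p\leq 2$, $1\leq l_0+l_p\leq 2$, and $1\leq l_i\leq 2$ for $i=1,\dots,p-1$. Furthermore, any string of this form is the top vertex of a maximal hypercube of $\Lambda_n$.
   Context: $Q_n$ is the $n$-dimensional hypercube: vertices are binary strings of length $n$, two adjacent iff they differ in exactly one coordinate. A Fibonacci string of length $n$ is a binary string $b_1\dots b_n$ with $b_ib_{i+1}=0$ for $1\le i<n$; it is a Lucas string if moreover $b_1b_n\neq 1$. The Lucas cube $\Lambda_n$ ($n\ge1$) is the subgraph of $Q_n$ induced by the Lucas strings of length $n$. The weight of a string is its number of 1's. A hypercube of dimension $p$ in $\Lambda_n$ is an induced subgraph isomorphic to $Q_p$; it is maximal if there is no induced subgraph $H'$ of $\Lambda_n$ with $H\subset H'$ and $H'$ isomorphic to $Q_{p+1}$. For an induced subgraph $H$ of $Q_n$ isomorphic to $Q_k$ there is a unique vertex of minimal weight, the bottom vertex $b(H)$, and a unique vertex of maximal weight, the top vertex $t(H)$. The notation $0^l$ denotes a string of $l$ zeros. -}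

module Defs where

open import Data.Bool using (Bool; true; false)
open import Data.Nat using (ℕ; zero; suc; _+_; _∸_; _≤_; _<_)
open import Data.Fin using (Fin; toℕ; fromℕ)
open import Data.Vec using (Vec; []; _∷_; head; last; lookup; replicate; toList)
import Data.List as L
open import Data.List using (List)
open import Data.Product using (Σ; ∃; _×_; _,_)
open import Data.Unit using (⊤)
open import Relation.Nullary using (¬_)
open import Relation.Binary.PropositionalEquality using (_≡_; _≢_)

Word : ℕ → Set
Word n = Vec Bool n

weight : ∀ {n} → Word n → ℕ
weight [] = 0
weight (true ∷ w) = suc (weight w)
weight (false ∷ w) = weight w

hamming : ∀ {n} → Word n → Word n → ℕ
hamming [] [] = 0
hamming (true ∷ u) (true ∷ v) = hamming u v
hamming (false ∷ u) (false ∷ v) = hamming u v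
hamming (true ∷ u) (false ∷ v) = suc (hamming u v)
hamming (false ∷ u) (true ∷ v) = suc (hamming u v)

Adj : ∀ {n} → Word n → Word n → Set
Adj u v = hamming u v ≡ 1

Fib : ∀ {n} → Word n → Set
Fib [] = ⊤
Fib (b ∷ []) = ⊤
Fib (b ∷ c ∷ w) = ¬ (b ≡ true × c ≡ true) × Fib (c ∷ w)

Lucas : ∀ {n} → Word n → Set
Lucas {zero} w = ⊤
Lucas {suc n} w = Fib w × ¬ (head w ≡ true × last w ≡ true)

-- A hypercube of dimension p in Λ_n: an induced subgraph of Λ_n isomorphic
-- to Q_p, given by an isomorphism f from Q_p onto it (H = image of f).
IsHypercube : (n p : ℕ) → (Word p → Word n) → Set
IsHypercube n p f =
  (∀ x → Lucas (f x)) ×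
  (∀ x y → f x ≡ f y → x ≡ y) ×
  (∀ x y → Adj x y → Adj (f x) (f y)) ×
  (∀ x y → Adj (f x) (f y) → Adj x y)

_∈H_ : ∀ {n p} → Word n → (Word p → Word n) → Set
v ∈H f = ∃ λ x → f x ≡ v

IsMaximal : (n p : ℕ) → (Word p → Word n) → Set
IsMaximal n p f =
  ¬ (Σ (Word (suc p) → Word n) λ g →
       IsHypercube n (suc p) g × (∀ x → f x ∈H g))

IsBottom : ∀ {n p} → (Word p → Word n) → Word n → Set
IsBottom f v = v ∈H f × (∀ y → f y ≢ v → weight v < weight (f y))

IsTop : ∀ {n p} → (Word p → Word n) → Word n → Set
IsTop f v = v ∈H f × (∀ y → f y ≢ v → weight (f y) < weight v)

topString : ∀ {p} → Vec ℕ (suc p) → List Bool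
topString (l ∷ ls) = L.replicate l false L.++ go ls
  where
  go : ∀ {k} → Vec ℕ k → List Bool
  go [] = L.[]
  go (k ∷ ks) = true L.∷ (L.replicate k false L.++ go ks)

sumV : ∀ {k} → Vec ℕ k → ℕ
sumV [] = 0
sumV (x ∷ xs) = x + sumV xs

GoodGaps : (n p : ℕ) → Vec ℕ (suc p) → Set
GoodGaps n p ls =
  sumV ls ≡ n ∸ p ×
  lookup ls Fin.zero ≤ 2 ×
  lookup ls (fromℕ p) ≤ 2 ×
  1 ≤ lookup ls Fin.zero + lookup ls (fromℕ p) ×
  lookup ls Fin.zero + lookup ls (fromℕ p) ≤ 2 ×
  (∀ (i : Fin (suc p)) → 1 ≤ toℕ i → toℕ i < p →
     1 ≤ lookup ls i × lookup ls i ≤ 2)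

zeros : (n : ℕ) → Word n
zeros n = replicate n false

module Submission where

-- A hypercube of Q_n is an isometric image of Q_p, and such images are exactly the translates
-- w ⊕ cube σ of the subcube spanned by p distinct coordinates σ (edges along the same direction
-- of Q_p are parallel).  Lucas strings are closed downwards, so if a hypercube H of Λ_n had w
-- nonzero outside σ, or its top t could gain a 1 inside Λ_n, a parallel copy of H would lie in
-- Λ_n and together they would form a Q_{p+1}.  Hence a maximal H is the interval [0^n, t], and
-- maximality of H amounts to t being saturated: no 0 of t can be turned into a 1 within Λ_n.
-- Conversely the interval below a saturated Lucas string is a maximal hypercube.  Read cyclically,
-- a Lucas string is saturated iff the gaps between consecutive 1's all have length 1 or 2; the
-- gap that wraps around has length l_0 + l_p, which gives the stated conditions.

open import Defs
open import Data.Nat using (ℕ; suc; _≤_)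
open import Data.Vec using (Vec; toList)
open import Data.Product using (Σ; _×_)
open import Relation.Binary.PropositionalEquality using (_≡_)

open import Data.Bool using (Bool; true; false; _xor_; not)
open import Data.Bool.Properties using (xor-comm; xor-assoc; xor-identityˡ; xor-identityʳ; xor-same)
open import Data.Empty using (⊥; ⊥-elim)
open import Data.Fin using (Fin; fromℕ; toℕ)
import Data.Fin as Fin
import Data.Fin.Properties as Finₚ
open import Data.List using (List; []; _∷_; _++_)
import Data.List as L
import Data.List.Properties as Lₚ
open import Data.Nat using (zero; _+_; _<_; _∸_; z≤n; s≤s)
open import Data.Nat.Properties
  using (≤-trans; n≤1+n; n<1+n; m≤n⇒m≤1+n; m≤m+n; m≤n+m; n≢0⇒n>0; suc-injective;
         +-comm; +-assoc; +-suc; +-identityʳ; m+n∸n≡m)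
open import Data.Product using (_,_; proj₁; proj₂; ∃; ∃₂)
open import Data.Sum using (_⊎_; inj₁; inj₂)
open import Data.Unit using (⊤; tt)
open import Data.Vec using ([]; _∷_; lookup; replicate; zipWith; last; init; map)
open import Data.Vec.Properties
  using (∷-injectiveʳ; length-toList; lookup-map; lookup-replicate; lookup-zipWith; tabulate∘lookup; tabulate-cong)
open import Data.Vec.Relation.Binary.Pointwise.Inductive
  using (Pointwise-≡⇒≡; zipWith-comm; zipWith-assoc; zipWith-identityˡ)
open import Data.Vec.Relation.Unary.All using (All; []; _∷_)
import Data.Vec.Relation.Unary.All as All
open import Function using (_∘_; case_of_)
open import Relation.Binary.PropositionalEquality
  using (refl; sym; trans; cong; cong₂; subst; subst₂; _≢_; ≢-sym; module ≡-Reasoning)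
open import Relation.Nullary using (¬_; yes; no)

private
  variable
    n p : ℕ

≡-by-lookup : ∀ {A : Set} {u v : Vec A n} → (∀ k → lookup u k ≡ lookup v k) → u ≡ v
≡-by-lookup {u = u} {v} eq = trans (sym (tabulate∘lookup u)) (trans (tabulate-cong eq) (tabulate∘lookup v))

infixr 6 _⊕_
_⊕_ : Word n → Word n → Word n
_⊕_ = zipWith _xor_

lookup-⊕ : ∀ (u v : Word n) k → lookup (u ⊕ v) k ≡ lookup u k xor lookup v k
lookup-⊕ u v k = lookup-zipWith _xor_ k u v

lookup-zeros : ∀ (k : Fin n) → lookup (zeros n) k ≡ false
lookup-zeros k = lookup-replicate k false

⊕-comm : ∀ (u v : Word n) → u ⊕ v ≡ v ⊕ u
⊕-comm u v = Pointwise-≡⇒≡ (zipWith-comm xor-comm u v)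

⊕-assoc : ∀ (u v w : Word n) → (u ⊕ v) ⊕ w ≡ u ⊕ (v ⊕ w)
⊕-assoc u v w = Pointwise-≡⇒≡ (zipWith-assoc xor-assoc u v w)

⊕-identityˡ : ∀ (u : Word n) → zeros n ⊕ u ≡ u
⊕-identityˡ u = Pointwise-≡⇒≡ (zipWith-identityˡ xor-identityˡ u)

⊕-identityʳ : ∀ (u : Word n) → u ⊕ zeros n ≡ u
⊕-identityʳ u = trans (⊕-comm u _) (⊕-identityˡ u)

⊕-self : ∀ (u : Word n) → u ⊕ u ≡ zeros n
⊕-self [] = refl
⊕-self (a ∷ u) = cong₂ _∷_ (xor-same a) (⊕-self u)

⊕-cancelˡ : ∀ (u v : Word n) → u ⊕ (u ⊕ v) ≡ v
⊕-cancelˡ u v = begin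
  u ⊕ (u ⊕ v)   ≡⟨ sym (⊕-assoc u u v) ⟩
  (u ⊕ u) ⊕ v   ≡⟨ cong (_⊕ v) (⊕-self u) ⟩
  zeros _ ⊕ v   ≡⟨ ⊕-identityˡ v ⟩
  v             ∎
  where open ≡-Reasoning

⊕-swap : ∀ (u v w : Word n) → u ⊕ (v ⊕ w) ≡ v ⊕ (u ⊕ w)
⊕-swap u v w = begin
  u ⊕ (v ⊕ w)   ≡⟨ sym (⊕-assoc u v w) ⟩
  (u ⊕ v) ⊕ w   ≡⟨ cong (_⊕ w) (⊕-comm u v) ⟩
  (v ⊕ u) ⊕ w   ≡⟨ ⊕-assoc v u w ⟩
  v ⊕ (u ⊕ w)   ∎
  where open ≡-Reasoning

⊕-cancel-shared : ∀ (w u v : Word n) → (w ⊕ u) ⊕ (w ⊕ v) ≡ u ⊕ v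
⊕-cancel-shared w u v = begin
  (w ⊕ u) ⊕ (w ⊕ v)   ≡⟨ ⊕-assoc w u (w ⊕ v) ⟩
  w ⊕ (u ⊕ (w ⊕ v))   ≡⟨ cong (w ⊕_) (⊕-swap u w v) ⟩
  w ⊕ (w ⊕ (u ⊕ v))   ≡⟨ ⊕-cancelˡ w (u ⊕ v) ⟩
  u ⊕ v               ∎
  where open ≡-Reasoning

⊕≡⇒≡⊕ : ∀ (u v w : Word n) → u ⊕ v ≡ w → v ≡ u ⊕ w
⊕≡⇒≡⊕ u v w eq = trans (sym (⊕-cancelˡ u v)) (cong (u ⊕_) eq)

unit : Fin n → Word n
unit Fin.zero = true ∷ zeros _
unit (Fin.suc k) = false ∷ unit k

lookup-unit-≡ : ∀ (k : Fin n) → lookup (unit k) k ≡ true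
lookup-unit-≡ Fin.zero = refl
lookup-unit-≡ (Fin.suc k) = lookup-unit-≡ k

lookup-unit-≢ : ∀ {k m : Fin n} → k ≢ m → lookup (unit k) m ≡ false
lookup-unit-≢ {k = Fin.zero} {Fin.zero} k≢m = ⊥-elim (k≢m refl)
lookup-unit-≢ {k = Fin.zero} {Fin.suc m} _ = lookup-zeros m
lookup-unit-≢ {k = Fin.suc k} {Fin.zero} _ = refl
lookup-unit-≢ {k = Fin.suc k} {Fin.suc m} k≢m = lookup-unit-≢ (λ k≡m → k≢m (cong Fin.suc k≡m))

lookup-unit⊕-≡ : ∀ (k : Fin n) (w : Word n) → lookup (unit k ⊕ w) k ≡ not (lookup w k)
lookup-unit⊕-≡ k w = trans (lookup-⊕ (unit k) w k) (cong (_xor lookup w k) (lookup-unit-≡ k))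

lookup-unit⊕-≢ : ∀ {k m : Fin n} (w : Word n) → k ≢ m → lookup (unit k ⊕ w) m ≡ lookup w m
lookup-unit⊕-≢ {k = k} {m} w k≢m = trans (lookup-⊕ (unit k) w m) (cong (_xor lookup w m) (lookup-unit-≢ k≢m))

ones : ∀ p → Word p
ones p = replicate p true

weight-zeros : ∀ n → weight (zeros n) ≡ 0
weight-zeros zero = refl
weight-zeros (suc n) = weight-zeros n

weight-ones : ∀ p → weight (ones p) ≡ p
weight-ones zero = refl
weight-ones (suc p) = cong suc (weight-ones p)

weight≡0⇒zeros : ∀ (w : Word n) → weight w ≡ 0 → w ≡ zeros n
weight≡0⇒zeros [] _ = refl
weight≡0⇒zeros (false ∷ w) eq = cong (false ∷_) (weight≡0⇒zeros w eq)

weight≤length : ∀ (w : Word n) → weight w ≤ n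
weight≤length [] = z≤n
weight≤length (true ∷ w) = s≤s (weight≤length w)
weight≤length (false ∷ w) = m≤n⇒m≤1+n (weight≤length w)

weight<length : ∀ (w : Word n) → w ≢ ones n → weight w < n
weight<length [] w≢ones = ⊥-elim (w≢ones refl)
weight<length (true ∷ w) w≢ones = s≤s (weight<length w (λ eq → w≢ones (cong (true ∷_) eq)))
weight<length (false ∷ w) _ = s≤s (weight≤length w)

weight<length⇒false : ∀ (w : Word n) → weight w < n → ∃ λ k → lookup w k ≡ false
weight<length⇒false (false ∷ w) _ = Fin.zero , refl
weight<length⇒false (true ∷ w) (s≤s lt) with weight<length⇒false w lt
... | k , eq = Fin.suc k , eq

weight-unit : ∀ (k : Fin n) → weight (unit k) ≡ 1
weight-unit {suc n} Fin.zero = cong suc (weight-zeros n)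
weight-unit (Fin.suc k) = weight-unit k

weight-unit⊕ : ∀ (k : Fin n) (w : Word n) → lookup w k ≡ false → weight (unit k ⊕ w) ≡ suc (weight w)
weight-unit⊕ Fin.zero (false ∷ w) _ = cong suc (cong weight (⊕-identityˡ w))
weight-unit⊕ (Fin.suc k) (true ∷ w) eq = cong suc (weight-unit⊕ k w eq)
weight-unit⊕ (Fin.suc k) (false ∷ w) eq = weight-unit⊕ k w eq

weight≡1⇒unit : ∀ (w : Word n) → weight w ≡ 1 → ∃ λ k → w ≡ unit k
weight≡1⇒unit (true ∷ w) eq = Fin.zero , cong (true ∷_) (weight≡0⇒zeros w (suc-injective eq))
weight≡1⇒unit (false ∷ w) eq with weight≡1⇒unit w eq
... | k , w≡unit = Fin.suc k , cong (false ∷_) w≡unit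

hamming≡weight-⊕ : ∀ (u v : Word n) → hamming u v ≡ weight (u ⊕ v)
hamming≡weight-⊕ [] [] = refl
hamming≡weight-⊕ (true ∷ u) (true ∷ v) = hamming≡weight-⊕ u v
hamming≡weight-⊕ (true ∷ u) (false ∷ v) = cong suc (hamming≡weight-⊕ u v)
hamming≡weight-⊕ (false ∷ u) (true ∷ v) = cong suc (hamming≡weight-⊕ u v)
hamming≡weight-⊕ (false ∷ u) (false ∷ v) = hamming≡weight-⊕ u v

hamming-⊕ˡ : ∀ (w u v : Word n) → hamming (w ⊕ u) (w ⊕ v) ≡ hamming u v
hamming-⊕ˡ w u v = begin
  hamming (w ⊕ u) (w ⊕ v)    ≡⟨ hamming≡weight-⊕ (w ⊕ u) (w ⊕ v) ⟩
  weight ((w ⊕ u) ⊕ (w ⊕ v)) ≡⟨ cong weight (⊕-cancel-shared w u v) ⟩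
  weight (u ⊕ v)             ≡⟨ hamming≡weight-⊕ u v ⟨
  hamming u v                ∎
  where open ≡-Reasoning

hamming-self : ∀ (u : Word n) → hamming u u ≡ 0
hamming-self [] = refl
hamming-self (true ∷ u) = hamming-self u
hamming-self (false ∷ u) = hamming-self u

hamming≡0⇒≡ : ∀ (u v : Word n) → hamming u v ≡ 0 → u ≡ v
hamming≡0⇒≡ [] [] _ = refl
hamming≡0⇒≡ (true ∷ u) (true ∷ v) eq = cong (true ∷_) (hamming≡0⇒≡ u v eq)
hamming≡0⇒≡ (false ∷ u) (false ∷ v) eq = cong (false ∷_) (hamming≡0⇒≡ u v eq)

Adj⇒unit⊕ : ∀ (u v : Word n) → Adj u v → ∃ λ k → v ≡ unit k ⊕ u
Adj⇒unit⊕ u v adj with weight≡1⇒unit (u ⊕ v) (trans (sym (hamming≡weight-⊕ u v)) adj)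
... | k , u⊕v≡unit = k , trans (⊕≡⇒≡⊕ u v _ u⊕v≡unit) (⊕-comm u (unit k))

-- The bitwise order; Lucas strings are closed downwards

infix 4 _⊑_
_⊑_ : Word n → Word n → Set
u ⊑ v = ∀ k → lookup u k ≡ true → lookup v k ≡ true

unit⊕-⊑ : ∀ (k : Fin n) (w : Word n) → lookup w k ≡ true → unit k ⊕ w ⊑ w
unit⊕-⊑ k w wₖ≡true m eq with k Fin.≟ m
... | yes refl = wₖ≡true
... | no k≢m = trans (sym (lookup-unit⊕-≢ w k≢m)) eq

⊑-unit⊕ : ∀ (k : Fin n) {u w : Word n} → lookup w k ≡ false → u ⊑ w → unit k ⊕ u ⊑ unit k ⊕ w
⊑-unit⊕ k {u} {w} wₖ≡false u⊑w m eq with k Fin.≟ m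
... | yes refl = trans (lookup-unit⊕-≡ k w) (cong not wₖ≡false)
... | no k≢m = trans (lookup-unit⊕-≢ w k≢m) (u⊑w m (trans (sym (lookup-unit⊕-≢ u k≢m)) eq))

last≡lookup-fromℕ : ∀ {A : Set} (v : Vec A (suc n)) → last v ≡ lookup v (fromℕ n)
last≡lookup-fromℕ (a ∷ []) = refl
last≡lookup-fromℕ (a ∷ b ∷ v) = last≡lookup-fromℕ (b ∷ v)

Fib-⊑ : ∀ {u v : Word n} → u ⊑ v → Fib v → Fib u
Fib-⊑ {u = []} {[]} _ _ = tt
Fib-⊑ {u = a ∷ []} {a′ ∷ []} _ _ = tt
Fib-⊑ {u = a ∷ b ∷ u} {a′ ∷ b′ ∷ v} u⊑v (¬11 , fib) =
  (λ (a≡true , b≡true) → ¬11 (u⊑v Fin.zero a≡true , u⊑v (Fin.suc Fin.zero) b≡true)) ,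
  Fib-⊑ (λ k → u⊑v (Fin.suc k)) fib

Lucas-⊑ : ∀ {u v : Word n} → u ⊑ v → Lucas v → Lucas u
Lucas-⊑ {zero} _ _ = tt
Lucas-⊑ {suc n} {a ∷ u} {b ∷ v} u⊑v (fib , ¬ends) =
  Fib-⊑ u⊑v fib ,
  λ (a≡true , lastu≡true) → ¬ends (u⊑v Fin.zero a≡true ,
    trans (last≡lookup-fromℕ (b ∷ v)) (u⊑v (fromℕ n) (trans (sym (last≡lookup-fromℕ (a ∷ u))) lastu≡true)))

infix 4 _∉_
_∉_ : Fin n → Vec (Fin n) p → Set
k ∉ σ = ∀ i → lookup σ i ≢ k

Distinct : Vec (Fin n) p → Set
Distinct [] = ⊤
Distinct (c ∷ σ) = c ∉ σ × Distinct σ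

∈-or-∉ : ∀ (k : Fin n) (σ : Vec (Fin n) p) → (∃ λ i → lookup σ i ≡ k) ⊎ k ∉ σ
∈-or-∉ k [] = inj₂ (λ ())
∈-or-∉ k (c ∷ σ) with c Fin.≟ k | ∈-or-∉ k σ
... | yes c≡k | _ = inj₁ (Fin.zero , c≡k)
... | no _ | inj₁ (i , σᵢ≡k) = inj₁ (Fin.suc i , σᵢ≡k)
... | no c≢k | inj₂ k∉σ = inj₂ λ { Fin.zero → c≢k ; (Fin.suc i) → k∉σ i }

cube : Vec (Fin n) p → Word p → Word n
cube [] [] = zeros _
cube (c ∷ σ) (false ∷ x) = cube σ x
cube (c ∷ σ) (true ∷ x) = unit c ⊕ cube σ x

cube-zeros : ∀ (σ : Vec (Fin n) p) → cube σ (zeros p) ≡ zeros n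
cube-zeros [] = refl
cube-zeros (c ∷ σ) = cube-zeros σ

cube-⊕ : ∀ (σ : Vec (Fin n) p) x y → cube σ (x ⊕ y) ≡ cube σ x ⊕ cube σ y
cube-⊕ [] [] [] = sym (⊕-self _)
cube-⊕ (c ∷ σ) (false ∷ x) (false ∷ y) = cube-⊕ σ x y
cube-⊕ (c ∷ σ) (false ∷ x) (true ∷ y) = trans (cong (unit c ⊕_) (cube-⊕ σ x y)) (⊕-swap (unit c) _ _)
cube-⊕ (c ∷ σ) (true ∷ x) (false ∷ y) = trans (cong (unit c ⊕_) (cube-⊕ σ x y)) (sym (⊕-assoc (unit c) _ _))
cube-⊕ (c ∷ σ) (true ∷ x) (true ∷ y) = trans (cube-⊕ σ x y) (sym (⊕-cancel-shared (unit c) _ _))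

cube-unit : ∀ (σ : Vec (Fin n) p) i → cube σ (unit i) ≡ unit (lookup σ i)
cube-unit (c ∷ σ) Fin.zero = trans (cong (unit c ⊕_) (cube-zeros σ)) (⊕-identityʳ (unit c))
cube-unit (c ∷ σ) (Fin.suc i) = cube-unit σ i

lookup-cube-∉ : ∀ {k : Fin n} (σ : Vec (Fin n) p) → k ∉ σ → ∀ x → lookup (cube σ x) k ≡ false
lookup-cube-∉ {k = k} [] _ [] = lookup-zeros k
lookup-cube-∉ (c ∷ σ) k∉ (false ∷ x) = lookup-cube-∉ σ (λ i → k∉ (Fin.suc i)) x
lookup-cube-∉ (c ∷ σ) k∉ (true ∷ x) =
  trans (lookup-unit⊕-≢ (cube σ x) (k∉ Fin.zero)) (lookup-cube-∉ σ (λ i → k∉ (Fin.suc i)) x)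

lookup-cube-∈ : ∀ (σ : Vec (Fin n) p) → Distinct σ → ∀ i x → lookup (cube σ x) (lookup σ i) ≡ lookup x i
lookup-cube-∈ (c ∷ σ) (c∉σ , _) Fin.zero (false ∷ x) = lookup-cube-∉ σ c∉σ x
lookup-cube-∈ (c ∷ σ) (c∉σ , _) Fin.zero (true ∷ x) =
  trans (lookup-unit⊕-≡ c (cube σ x)) (cong not (lookup-cube-∉ σ c∉σ x))
lookup-cube-∈ (c ∷ σ) (_ , dσ) (Fin.suc i) (false ∷ x) = lookup-cube-∈ σ dσ i x
lookup-cube-∈ (c ∷ σ) (c∉σ , dσ) (Fin.suc i) (true ∷ x) =
  trans (lookup-unit⊕-≢ (cube σ x) (λ c≡σᵢ → c∉σ i (sym c≡σᵢ))) (lookup-cube-∈ σ dσ i x)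

weight-cube : ∀ (σ : Vec (Fin n) p) → Distinct σ → ∀ x → weight (cube σ x) ≡ weight x
weight-cube {n} [] _ [] = weight-zeros n
weight-cube (c ∷ σ) (_ , dσ) (false ∷ x) = weight-cube σ dσ x
weight-cube (c ∷ σ) (c∉σ , dσ) (true ∷ x) =
  trans (weight-unit⊕ c (cube σ x) (lookup-cube-∉ σ c∉σ x)) (cong suc (weight-cube σ dσ x))

hamming-cube : ∀ (σ : Vec (Fin n) p) → Distinct σ → ∀ x y → hamming (cube σ x) (cube σ y) ≡ hamming x y
hamming-cube σ dσ x y = begin
  hamming (cube σ x) (cube σ y)   ≡⟨ hamming≡weight-⊕ (cube σ x) (cube σ y) ⟩
  weight (cube σ x ⊕ cube σ y)    ≡⟨ cong weight (cube-⊕ σ x y) ⟨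
  weight (cube σ (x ⊕ y))         ≡⟨ weight-cube σ dσ (x ⊕ y) ⟩
  weight (x ⊕ y)                  ≡⟨ hamming≡weight-⊕ x y ⟨
  hamming x y                     ∎
  where open ≡-Reasoning

cube-⊑-top : ∀ (σ : Vec (Fin n) p) → Distinct σ → ∀ x → cube σ x ⊑ cube σ (ones p)
cube-⊑-top σ dσ x k eq with ∈-or-∉ k σ
... | inj₁ (i , refl) = trans (lookup-cube-∈ σ dσ i (ones _)) (lookup-replicate i true)
... | inj₂ k∉σ with trans (sym eq) (lookup-cube-∉ σ k∉σ x)
...   | ()

cube-map-suc : ∀ (σ : Vec (Fin n) p) x → cube (map Fin.suc σ) x ≡ false ∷ cube σ x
cube-map-suc [] [] = refl
cube-map-suc (c ∷ σ) (false ∷ x) = cube-map-suc σ x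
cube-map-suc (c ∷ σ) (true ∷ x) = cong (unit (Fin.suc c) ⊕_) (cube-map-suc σ x)

∉-map-suc : ∀ {k : Fin n} (σ : Vec (Fin n) p) → k ∉ σ → Fin.suc k ∉ map Fin.suc σ
∉-map-suc σ k∉σ i eq = k∉σ i (Finₚ.suc-injective (trans (sym (lookup-map i Fin.suc σ)) eq))

zero∉map-suc : ∀ (σ : Vec (Fin n) p) → Fin.zero ∉ map Fin.suc σ
zero∉map-suc σ i eq with trans (sym eq) (lookup-map i Fin.suc σ)
... | ()

Distinct-map-suc : ∀ (σ : Vec (Fin n) p) → Distinct σ → Distinct (map Fin.suc σ)
Distinct-map-suc [] _ = tt
Distinct-map-suc (c ∷ σ) (c∉σ , dσ) = ∉-map-suc σ c∉σ , Distinct-map-suc σ dσ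

support : ∀ (t : Word n) → Σ (Vec (Fin n) (weight t)) λ σ → Distinct σ × cube σ (ones _) ≡ t
support [] = [] , tt , refl
support (false ∷ t) with support t
... | σ , dσ , eq = map Fin.suc σ , Distinct-map-suc σ dσ , trans (cube-map-suc σ _) (cong (false ∷_) eq)
support (true ∷ t) with support t
... | σ , dσ , eq =
  Fin.zero ∷ map Fin.suc σ , (zero∉map-suc σ , Distinct-map-suc σ dσ) ,
  trans (cong (unit Fin.zero ⊕_) (cube-map-suc σ _)) (cong (true ∷_) (trans (⊕-identityˡ _) eq))

-- Hypercubes of Q_n are translated subcubes

IsEmbedding : (Word p → Word n) → Set
IsEmbedding f =
  (∀ x y → f x ≡ f y → x ≡ y) ×
  (∀ x y → Adj x y → Adj (f x) (f y)) ×
  (∀ x y → Adj (f x) (f y) → Adj x y)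

isometry⇒embedding : ∀ {f : Word p → Word n} → (∀ x y → hamming (f x) (f y) ≡ hamming x y) → IsEmbedding f
isometry⇒embedding {f = f} iso =
  (λ x y fx≡fy → hamming≡0⇒≡ x y
     (trans (sym (iso x y)) (trans (cong (hamming (f x)) (sym fx≡fy)) (hamming-self (f x))))) ,
  (λ x y adj → trans (iso x y) adj) ,
  (λ x y adj → trans (sym (iso x y)) adj)

translated-cube-embedding : ∀ (w : Word n) (σ : Vec (Fin n) p) → Distinct σ → IsEmbedding (λ x → w ⊕ cube σ x)
translated-cube-embedding w σ dσ =
  isometry⇒embedding λ x y → trans (hamming-⊕ˡ w (cube σ x) (cube σ y)) (hamming-cube σ dσ x y)

adj-cons : ∀ (x : Word p) → Adj (false ∷ x) (true ∷ x)
adj-cons x = cong suc (hamming-self x)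

Q-induction : ∀ (P : Word p → Set) → P (zeros p) → (∀ x y → Adj x y → P x → P y) → ∀ x → P x
Q-induction {zero} P P0 step [] = P0
Q-induction {suc p} P P0 step (b ∷ x) = lift b (Q-induction (λ y → P (false ∷ y)) P0 (λ _ _ adj → step _ _ adj) x)
  where
  lift : ∀ b → P (false ∷ x) → P (b ∷ x)
  lift false Px = Px
  lift true Px = step (false ∷ x) (true ∷ x) (adj-cons x) Px

weight-three-units : ∀ {c d a : Fin n} → c ≢ d → c ≢ a → d ≢ a → weight (unit c ⊕ (unit d ⊕ unit a)) ≡ 3
weight-three-units {c = c} {d} {a} c≢d c≢a d≢a = begin
  weight (unit c ⊕ (unit d ⊕ unit a))   ≡⟨ weight-unit⊕ c _ c∉da ⟩
  suc (weight (unit d ⊕ unit a))        ≡⟨ cong suc (weight-unit⊕ d (unit a) (lookup-unit-≢ (≢-sym d≢a))) ⟩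
  suc (suc (weight (unit a)))           ≡⟨ cong (suc ∘ suc) (weight-unit a) ⟩
  3                                     ∎
  where
  open ≡-Reasoning
  c∉da : lookup (unit d ⊕ unit a) c ≡ false
  c∉da = trans (lookup-unit⊕-≢ (unit a) (≢-sym c≢d)) (lookup-unit-≢ (≢-sym c≢a))

parallel-edge : ∀ {f : Word (suc p) → Word n} → IsEmbedding f → ∀ {c : Fin n} x y → Adj x y →
  f (true ∷ x) ≡ unit c ⊕ f (false ∷ x) → f (true ∷ y) ≡ unit c ⊕ f (false ∷ y)
parallel-edge {f = f} (injective , adj⁺ , _) {c} x y x~y f1x≡
  with Adj⇒unit⊕ (f (false ∷ x)) (f (false ∷ y)) (adj⁺ _ _ x~y)
     | Adj⇒unit⊕ (f (false ∷ y)) (f (true ∷ y)) (adj⁺ _ _ (adj-cons y))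
... | a , f0y≡ | d , f1y≡ = subst (λ e → f (true ∷ y) ≡ unit e ⊕ f (false ∷ y)) (sym c≡d) f1y≡
  where
  W : Word _
  W = f (false ∷ x)
  c≢a : c ≢ a
  c≢a refl with injective (true ∷ x) (false ∷ y) (trans f1x≡ (sym f0y≡))
  ... | ()
  d≢a : d ≢ a
  d≢a refl with injective (true ∷ y) (false ∷ x)
                  (trans f1y≡ (trans (cong (unit d ⊕_) f0y≡) (⊕-cancelˡ (unit d) W)))
  ... | ()
  one-apart : weight (unit c ⊕ (unit d ⊕ unit a)) ≡ 1
  one-apart = begin
    weight (unit c ⊕ (unit d ⊕ unit a))                         ≡⟨ cong weight (⊕-cancel-shared W _ _) ⟨
    weight ((W ⊕ unit c) ⊕ (W ⊕ (unit d ⊕ unit a)))             ≡⟨ cong weight (cong₂ _⊕_ (⊕-comm W _) (⊕-comm W _)) ⟩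
    weight ((unit c ⊕ W) ⊕ ((unit d ⊕ unit a) ⊕ W))             ≡⟨ cong weight (cong₂ _⊕_ f1x≡ f1y≡′) ⟨
    weight (f (true ∷ x) ⊕ f (true ∷ y))                         ≡⟨ hamming≡weight-⊕ (f (true ∷ x)) (f (true ∷ y)) ⟨
    hamming (f (true ∷ x)) (f (true ∷ y))                        ≡⟨ adj⁺ _ _ x~y ⟩
    1                                                            ∎
    where
    open ≡-Reasoning
    f1y≡′ : f (true ∷ y) ≡ (unit d ⊕ unit a) ⊕ W
    f1y≡′ = trans f1y≡ (trans (cong (unit d ⊕_) f0y≡) (sym (⊕-assoc (unit d) (unit a) W)))
  -- Otherwise c, d and a are distinct and f (true ∷ x), f (true ∷ y) would be 3 apart.
  c≡d : c ≡ d
  c≡d with c Fin.≟ d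
  ... | yes c≡d = c≡d
  ... | no c≢d with trans (sym (weight-three-units c≢d c≢a d≢a)) one-apart
  ...   | ()

restrict-embedding : ∀ {f : Word (suc p) → Word n} → IsEmbedding f → IsEmbedding (f ∘ (false ∷_))
restrict-embedding (injective , adj⁺ , adj⁻) =
  (λ x y eq → ∷-injectiveʳ (injective _ _ eq)) , (λ x y → adj⁺ _ _) , (λ x y → adj⁻ _ _)

embedding⇒translated-cube : ∀ {f : Word p → Word n} → IsEmbedding f →
  Σ (Vec (Fin n) p) λ σ → Distinct σ × (∀ x → f x ≡ f (zeros p) ⊕ cube σ x)
embedding⇒translated-cube {zero} _ = [] , tt , λ { [] → sym (⊕-identityʳ _) }
embedding⇒translated-cube {suc p} {n} {f} emb@(injective , adj⁺ , _)
  with embedding⇒translated-cube (restrict-embedding emb)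
     | Adj⇒unit⊕ (f (false ∷ zeros p)) (f (true ∷ zeros p)) (adj⁺ _ _ (adj-cons (zeros p)))
... | σ , dσ , f₀≡ | c , f₁₀≡ = c ∷ σ , (c∉σ , dσ) , f≡
  where
  f₀ f₁ : Word p → Word n
  f₀ x = f (false ∷ x)
  f₁ x = f (true ∷ x)
  f₁≡ : ∀ x → f₁ x ≡ unit c ⊕ f₀ x
  f₁≡ = Q-induction (λ x → f₁ x ≡ unit c ⊕ f₀ x) f₁₀≡ (parallel-edge emb)
  c∉σ : c ∉ σ
  c∉σ i σᵢ≡c with injective (true ∷ zeros p) (false ∷ unit i) (begin
    f₁ (zeros p)                        ≡⟨ f₁≡ (zeros p) ⟩
    unit c ⊕ f₀ (zeros p)               ≡⟨ ⊕-comm _ _ ⟩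
    f₀ (zeros p) ⊕ unit c               ≡⟨ cong (λ e → f₀ (zeros p) ⊕ unit e) σᵢ≡c ⟨
    f₀ (zeros p) ⊕ unit (lookup σ i)    ≡⟨ cong (f₀ (zeros p) ⊕_) (cube-unit σ i) ⟨
    f₀ (zeros p) ⊕ cube σ (unit i)      ≡⟨ f₀≡ (unit i) ⟨
    f₀ (unit i)                         ∎)
    where open ≡-Reasoning
  ... | ()
  f≡ : ∀ x → f x ≡ f (zeros (suc p)) ⊕ cube (c ∷ σ) x
  f≡ (false ∷ x) = f₀≡ x
  f≡ (true ∷ x) =
    trans (f₁≡ x) (trans (cong (unit c ⊕_) (f₀≡ x)) (⊕-swap (unit c) (f₀ (zeros p)) (cube σ x)))

-- Maximal hypercubes of Λ_n and saturated Lucas strings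

lookup-translated-cube-∉ : ∀ {k : Fin n} (w : Word n) (σ : Vec (Fin n) p) → k ∉ σ →
  ∀ x → lookup (w ⊕ cube σ x) k ≡ lookup w k
lookup-translated-cube-∉ {k = k} w σ k∉σ x =
  trans (lookup-⊕ w (cube σ x) k) (trans (cong (lookup w k xor_) (lookup-cube-∉ σ k∉σ x)) (xor-identityʳ _))

extend-by-free-coordinate : ∀ {f : Word p → Word n} {w σ} → (∀ x → f x ≡ w ⊕ cube σ x) → Distinct σ →
  ∀ {k} → k ∉ σ → (∀ x → Lucas (f x)) → (∀ x → Lucas (unit k ⊕ f x)) →
  Σ (Word (suc p) → Word n) λ g → IsHypercube n (suc p) g × (∀ x → f x ∈H g)
extend-by-free-coordinate {f = f} {w} {σ} f≡ dσ {k} k∉σ lucas lucas-flip =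
  g , (lucas-g , translated-cube-embedding w (k ∷ σ) (k∉σ , dσ)) , λ x → false ∷ x , sym (f≡ x)
  where
  g : Word (suc _) → Word _
  g x = w ⊕ cube (k ∷ σ) x
  lucas-g : ∀ x → Lucas (g x)
  lucas-g (false ∷ x) = subst Lucas (f≡ x) (lucas x)
  lucas-g (true ∷ x) = subst Lucas (trans (cong (unit k ⊕_) (f≡ x)) (⊕-swap (unit k) w (cube σ x))) (lucas-flip x)

translated-cube-as-cube : ∀ {f : Word p → Word n} {w σ b} → (∀ x → f x ≡ w ⊕ cube σ x) → w ≡ cube σ b →
  ∀ x → f x ≡ cube σ (b ⊕ x)
translated-cube-as-cube {σ = σ} {b} f≡ refl x = trans (f≡ x) (sym (cube-⊕ σ b x))

translated-cube-through-zero : ∀ {f : Word p → Word n} {σ z₀} → (∀ x → f x ≡ f (zeros p) ⊕ cube σ x) →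
  f z₀ ≡ zeros n → ∀ x → f x ≡ cube σ (z₀ ⊕ x)
translated-cube-through-zero {f = f} {σ} {z₀} f≡ fz₀≡0 = translated-cube-as-cube {σ = σ} {z₀} f≡
  (trans (sym (⊕-identityʳ _))
    (sym (⊕≡⇒≡⊕ (f (zeros _)) (cube σ z₀) (zeros _) (trans (sym (f≡ z₀)) fz₀≡0))))

zeros-bottom : ∀ {f : Word p → Word n} → zeros n ∈H f → IsBottom f (zeros n)
zeros-bottom {n = n} {f = f} zeros∈f =
  zeros∈f , λ y fy≢0 → subst (_< weight (f y)) (sym (weight-zeros n)) (n≢0⇒n>0 (fy≢0 ∘ weight≡0⇒zeros (f y)))

cube-top : ∀ {f : Word p → Word n} {σ b} → Distinct σ → (∀ x → f x ≡ cube σ (b ⊕ x)) →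
  IsTop f (cube σ (ones p))
cube-top {p = p} {f = f} {σ} {b} dσ f≡ = (b ⊕ ones p , trans (f≡ _) (cong (cube σ) (⊕-cancelˡ b (ones p)))) , below
  where
  below : ∀ y → f y ≢ cube σ (ones p) → weight (f y) < weight (cube σ (ones p))
  below y fy≢t = subst₂ _<_
    (sym (trans (cong weight (f≡ y)) (weight-cube σ dσ _)))
    (sym (trans (weight-cube σ dσ (ones p)) (weight-ones p)))
    (weight<length (b ⊕ y) (λ eq → fy≢t (trans (f≡ y) (cong (cube σ) eq))))

Saturated : Word n → Set
Saturated t = ∀ k → lookup t k ≡ false → ¬ Lucas (unit k ⊕ t)

supported-by-cube : ∀ {w : Word n} (σ : Vec (Fin n) p) → Distinct σ → (∀ k → k ∉ σ → lookup w k ≡ false) →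
  w ≡ cube σ (map (lookup w) σ)
supported-by-cube {w = w} σ dσ off-σ = ≡-by-lookup λ k → lookup-at k (∈-or-∉ k σ)
  where
  lookup-at : ∀ k → (∃ λ i → lookup σ i ≡ k) ⊎ k ∉ σ → lookup w k ≡ lookup (cube σ (map (lookup w) σ)) k
  lookup-at k (inj₁ (i , refl)) = sym (trans (lookup-cube-∈ σ dσ i _) (lookup-map i (lookup w) σ))
  lookup-at k (inj₂ k∉σ) = trans (off-σ k k∉σ) (sym (lookup-cube-∉ σ k∉σ _))

maximal⇒cube-through-zero : ∀ {f : Word p → Word n} → IsHypercube n p f → IsMaximal n p f →
  Σ (Vec (Fin n) p) λ σ → Distinct σ × Σ (Word p) λ b → ∀ x → f x ≡ cube σ (b ⊕ x)
maximal⇒cube-through-zero {p = p} {f = f} (lucas , embedding) maximal with embedding⇒translated-cube embedding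
... | σ , dσ , f≡ = σ , dσ , b , translated-cube-as-cube {σ = σ} {b} f≡ (supported-by-cube σ dσ off-σ)
  where
  b : Word p
  b = map (lookup (f (zeros p))) σ
  off-σ : ∀ k → k ∉ σ → lookup (f (zeros p)) k ≡ false
  off-σ k k∉σ with lookup (f (zeros p)) k in f₀ₖ≡
  ... | false = refl
  ... | true = ⊥-elim (maximal (extend-by-free-coordinate f≡ dσ k∉σ lucas λ x →
    Lucas-⊑ (unit⊕-⊑ k (f x) (trans (cong (λ v → lookup v k) (f≡ x))
      (trans (lookup-translated-cube-∉ (f (zeros p)) σ k∉σ x) f₀ₖ≡))) (lucas x)))

maximal⇒top-saturated : ∀ {f : Word p → Word n} {σ b} → IsHypercube n p f → IsMaximal n p f →
  Distinct σ → (∀ x → f x ≡ cube σ (b ⊕ x)) → Saturated (cube σ (ones p))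
maximal⇒top-saturated {p = p} {f = f} {σ} {b} (lucas , _) maximal dσ f≡ k tₖ≡false lucas-flip
  with ∈-or-∉ k σ
... | inj₁ (i , refl) with trans (sym tₖ≡false) (trans (lookup-cube-∈ σ dσ i (ones p)) (lookup-replicate i true))
...   | ()
maximal⇒top-saturated {p = p} {f = f} {σ} {b} (lucas , _) maximal dσ f≡ k tₖ≡false lucas-flip
    | inj₂ k∉σ = maximal (extend-by-free-coordinate f≡′ dσ k∉σ lucas λ x →
      Lucas-⊑ (⊑-unit⊕ k tₖ≡false (subst (_⊑ cube σ (ones p)) (sym (f≡ x)) (cube-⊑-top σ dσ (b ⊕ x))))
        lucas-flip)
  where
  f≡′ : ∀ x → f x ≡ cube σ b ⊕ cube σ x
  f≡′ x = trans (f≡ x) (cube-⊕ σ b x)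

unsaturated-below-top : ∀ (τ : Vec (Fin n) p) → Distinct τ → (∀ x → Lucas (cube τ x)) →
  ∀ w → weight w < p → ¬ Saturated (cube τ w)
unsaturated-below-top τ dτ lucas w light saturated with weight<length⇒false w light
... | i , wᵢ≡false = saturated (lookup τ i) (trans (lookup-cube-∈ τ dτ i w) wᵢ≡false)
  (subst Lucas (trans (cube-⊕ τ (unit i) w) (cong (_⊕ cube τ w) (cube-unit τ i))) (lucas (unit i ⊕ w)))

saturated⇒maximal-cube : ∀ (σ : Vec (Fin n) p) → Distinct σ →
  Lucas (cube σ (ones p)) → Saturated (cube σ (ones p)) →
  IsHypercube n p (cube σ) × IsMaximal n p (cube σ) × IsTop (cube σ) (cube σ (ones p))
saturated⇒maximal-cube {p = p} σ dσ lucas-t saturated =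
  (lucas , embedding) , maximal ,
  cube-top dσ (λ x → cong (cube σ) (sym (⊕-identityˡ x)))
  where
  lucas : ∀ x → Lucas (cube σ x)
  lucas x = Lucas-⊑ (cube-⊑-top σ dσ x) lucas-t
  embedding : IsEmbedding (cube σ)
  embedding = isometry⇒embedding (hamming-cube σ dσ)
  maximal : IsMaximal _ p (cube σ)
  -- A hypercube g containing cube σ passes through 0, so it is a subcube cube τ in which the
  -- top t of cube σ has weight p < p + 1 and can therefore be raised.
  maximal (g , (lucas-g , embedding-g) , contains) with embedding⇒translated-cube embedding-g
  ... | τ , dτ , g≡g₀⊕ =
    unsaturated-below-top τ dτ
      (λ x → subst Lucas (trans (g≡ (z₀ ⊕ x)) (cong (cube τ) (⊕-cancelˡ z₀ x))) (lucas-g _))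
      (z₀ ⊕ zₜ) (subst (_< suc p) (sym weight-t) (n<1+n p)) (subst Saturated t≡ saturated)
    where
    z₀ zₜ : Word (suc p)
    z₀ = proj₁ (contains (zeros p))
    zₜ = proj₁ (contains (ones p))
    g≡ : ∀ x → g x ≡ cube τ (z₀ ⊕ x)
    g≡ = translated-cube-through-zero {σ = τ} g≡g₀⊕ (trans (proj₂ (contains (zeros p))) (cube-zeros σ))
    t≡ : cube σ (ones p) ≡ cube τ (z₀ ⊕ zₜ)
    t≡ = trans (sym (proj₂ (contains (ones p)))) (g≡ zₜ)
    weight-t : weight (z₀ ⊕ zₜ) ≡ p
    weight-t = trans (sym (weight-cube τ dτ (z₀ ⊕ zₜ)))
      (trans (cong weight (sym t≡)) (trans (weight-cube σ dσ (ones p)) (weight-ones p)))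

0^_ : ℕ → List Bool
0^ l = L.replicate l false

FibL : List Bool → Set
FibL [] = ⊤
FibL (b ∷ []) = ⊤
FibL (b ∷ c ∷ w) = ¬ (b ≡ true × c ≡ true) × FibL (c ∷ w)

headL : List Bool → Bool
headL [] = false
headL (b ∷ _) = b

lastL : List Bool → Bool
lastL [] = false
lastL (b ∷ []) = b
lastL (_ ∷ c ∷ w) = lastL (c ∷ w)

LucasL : List Bool → Set
LucasL w = FibL w × ¬ (headL w ≡ true × lastL w ≡ true)

SaturatedL : List Bool → Set
SaturatedL w = ∀ a b → w ≡ a ++ false ∷ b → ¬ LucasL (a ++ true ∷ b)

Fib⇒FibL : ∀ (t : Word n) → Fib t → FibL (toList t)
Fib⇒FibL [] _ = tt
Fib⇒FibL (a ∷ []) _ = tt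
Fib⇒FibL (a ∷ b ∷ t) (¬11 , fib) = ¬11 , Fib⇒FibL (b ∷ t) fib

FibL⇒Fib : ∀ (t : Word n) → FibL (toList t) → Fib t
FibL⇒Fib [] _ = tt
FibL⇒Fib (a ∷ []) _ = tt
FibL⇒Fib (a ∷ b ∷ t) (¬11 , fib) = ¬11 , FibL⇒Fib (b ∷ t) fib

last≡lastL : ∀ (t : Word (suc n)) → last t ≡ lastL (toList t)
last≡lastL (a ∷ []) = refl
last≡lastL (a ∷ b ∷ t) = last≡lastL (b ∷ t)

Lucas⇒LucasL : ∀ (t : Word n) → Lucas t → LucasL (toList t)
Lucas⇒LucasL [] _ = tt , λ ()
Lucas⇒LucasL (a ∷ t) (fib , ¬ends) =
  Fib⇒FibL (a ∷ t) fib , λ (h , l) → ¬ends (h , trans (last≡lastL (a ∷ t)) l)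

LucasL⇒Lucas : ∀ (t : Word n) → LucasL (toList t) → Lucas t
LucasL⇒Lucas [] _ = tt
LucasL⇒Lucas (a ∷ t) (fib , ¬ends) =
  FibL⇒Fib (a ∷ t) fib , λ (h , l) → ¬ends (h , trans (sym (last≡lastL (a ∷ t))) l)

toList-unit⊕ : ∀ (t : Word n) k → ∃₂ λ a b →
  toList t ≡ a ++ lookup t k ∷ b × toList (unit k ⊕ t) ≡ a ++ not (lookup t k) ∷ b
toList-unit⊕ (x ∷ t) Fin.zero = [] , toList t , refl , cong (λ v → not x ∷ toList v) (⊕-identityˡ t)
toList-unit⊕ (x ∷ t) (Fin.suc k) with toList-unit⊕ t k
... | a , b , t≡ , t′≡ = x ∷ a , b , cong (x ∷_) t≡ , cong (x ∷_) t′≡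

toList≡split : ∀ (t : Word n) a b → toList t ≡ a ++ false ∷ b →
  ∃ λ k → lookup t k ≡ false × toList (unit k ⊕ t) ≡ a ++ true ∷ b
toList≡split (x ∷ t) [] b eq with Lₚ.∷-injective eq
... | refl , t≡b = Fin.zero , refl , cong (true ∷_) (trans (cong toList (⊕-identityˡ t)) t≡b)
toList≡split (x ∷ t) (y ∷ a) b eq with Lₚ.∷-injective eq
... | refl , t≡ with toList≡split t a b t≡
...   | k , tₖ≡false , t′≡ = Fin.suc k , tₖ≡false , cong (x ∷_) t′≡

Saturated⇒SaturatedL : ∀ (t : Word n) → Saturated t → SaturatedL (toList t)
Saturated⇒SaturatedL t saturated a b t≡ lucas with toList≡split t a b t≡
... | k , tₖ≡false , t′≡ = saturated k tₖ≡false (LucasL⇒Lucas (unit k ⊕ t) (subst LucasL (sym t′≡) lucas))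

SaturatedL⇒Saturated : ∀ (t : Word n) → SaturatedL (toList t) → Saturated t
SaturatedL⇒Saturated t saturated k tₖ≡false lucas with toList-unit⊕ t k
... | a , b , t≡ , t′≡ rewrite tₖ≡false =
  saturated a b t≡ (subst LucasL t′≡ (Lucas⇒LucasL (unit k ⊕ t) lucas))

-- Saturation is a local condition

FibL-tail : ∀ x w → FibL (x ∷ w) → FibL w
FibL-tail x [] _ = tt
FibL-tail x (y ∷ w) (_ , fib) = fib

FibL-++⁻ʳ : ∀ a {w} → FibL (a ++ w) → FibL w
FibL-++⁻ʳ [] fib = fib
FibL-++⁻ʳ (x ∷ a) fib = FibL-++⁻ʳ a (FibL-tail x _ fib)

FibL-0∷ : ∀ w → FibL w → FibL (false ∷ w)
FibL-0∷ [] _ = tt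
FibL-0∷ (x ∷ w) fib = (λ ()) , fib

FibL-0^++ : ∀ l {w} → FibL w → FibL (0^ l ++ w)
FibL-0^++ zero fib = fib
FibL-0^++ (suc l) fib = FibL-0∷ _ (FibL-0^++ l fib)

FibL-replace : ∀ u {r r′} → FibL (u ++ false ∷ r) → FibL (false ∷ r′) → FibL (u ++ false ∷ r′)
FibL-replace [] _ fib′ = fib′
FibL-replace (x ∷ []) (¬11 , _) fib′ = ¬11 , fib′
FibL-replace (x ∷ y ∷ u) (¬11 , fib) fib′ = ¬11 , FibL-replace (y ∷ u) fib fib′

FibL-around-1 : ∀ a b → FibL (a ++ true ∷ b) → lastL a ≡ false × headL b ≡ false
FibL-around-1 [] [] _ = refl , refl
FibL-around-1 [] (false ∷ b) _ = refl , refl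
FibL-around-1 [] (true ∷ b) (¬11 , _) = ⊥-elim (¬11 (refl , refl))
FibL-around-1 (false ∷ []) b (_ , fib) = refl , proj₂ (FibL-around-1 [] b fib)
FibL-around-1 (true ∷ []) b (¬11 , _) = ⊥-elim (¬11 (refl , refl))
FibL-around-1 (x ∷ y ∷ a) b (_ , fib) = FibL-around-1 (y ∷ a) b fib

headL-++-∷ : ∀ a {x} r r′ → headL (a ++ x ∷ r) ≡ headL (a ++ x ∷ r′)
headL-++-∷ [] r r′ = refl
headL-++-∷ (y ∷ a) r r′ = refl

lastL-++-∷ : ∀ a x r → lastL (a ++ x ∷ r) ≡ lastL (x ∷ r)
lastL-++-∷ [] x r = refl
lastL-++-∷ (y ∷ []) x r = refl
lastL-++-∷ (y ∷ z ∷ a) x r = lastL-++-∷ (z ∷ a) x r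

lastL≡false : ∀ a → lastL a ≡ false → a ≡ [] ⊎ ∃ λ a′ → a ≡ a′ ++ false ∷ []
lastL≡false [] _ = inj₁ refl
lastL≡false (false ∷ []) _ = inj₂ ([] , refl)
lastL≡false (x ∷ y ∷ a) eq with lastL≡false (y ∷ a) eq
... | inj₂ (a′ , eq′) = inj₂ (x ∷ a′ , cong (x ∷_) eq′)

headL≡false : ∀ b → headL b ≡ false → b ≡ [] ⊎ ∃ λ b′ → b ≡ false ∷ b′
headL≡false [] _ = inj₁ refl
headL≡false (false ∷ b) _ = inj₂ (b , refl)

No000 : List Bool → Set
No000 w = ∀ u v → w ≢ u ++ false ∷ false ∷ false ∷ v

-- A 0 can be raised exactly when both of its cyclic neighbours are 0.
record LocallySaturated (w : List Bool) : Set where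
  field
    no000 : No000 w
    00-prefix : ∀ v → w ≡ false ∷ false ∷ v → lastL w ≡ true
    00-suffix : ∀ u → w ≡ u ++ false ∷ false ∷ [] → headL w ≡ true

LucasL-replace : ∀ u {r r′} → LucasL (u ++ false ∷ r) → FibL (false ∷ r′) →
  lastL (false ∷ r′) ≡ lastL (false ∷ r) →
  LucasL (u ++ false ∷ r′)
LucasL-replace u {r} {r′} (fib , ¬ends) fib′ same-last =
  FibL-replace u fib fib′ ,
  λ (h , l) → ¬ends (trans (headL-++-∷ u r r′) h ,
    trans (lastL-++-∷ u false r) (trans (sym same-last) (trans (sym (lastL-++-∷ u false r′)) l)))

saturatedL⇒locally : ∀ {w} → LucasL w → SaturatedL w → LocallySaturated w
saturatedL⇒locally {w} lucas@(fib , ¬ends) saturated = record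
  { no000 = no000 ; 00-prefix = 00-prefix ; 00-suffix = 00-suffix }
  where
  no000 : No000 w
  no000 u v w≡ = saturated (u ++ false ∷ []) (false ∷ v) (trans w≡ (sym (Lₚ.++-assoc u _ _)))
    (subst LucasL (sym (Lₚ.++-assoc u (false ∷ []) _))
      (LucasL-replace u (subst LucasL w≡ lucas) ((λ ()) , (λ ()) , fib000) refl))
    where
    fib000 : FibL (false ∷ v)
    fib000 = proj₂ (proj₂ (FibL-++⁻ʳ u (subst FibL w≡ fib)))
  00-prefix : ∀ v → w ≡ false ∷ false ∷ v → lastL w ≡ true
  00-prefix v w≡ with lastL w in lastw≡
  ... | true = refl
  ... | false = ⊥-elim (saturated [] (false ∷ v) w≡
    (((λ ()) , proj₂ (subst FibL w≡ fib)) ,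
     λ (_ , l) → case trans (sym l) (trans (cong lastL (sym w≡)) lastw≡) of λ ()))
  00-suffix : ∀ u → w ≡ u ++ false ∷ false ∷ [] → headL w ≡ true
  00-suffix u w≡ with headL w in headw≡
  ... | true = refl
  ... | false = ⊥-elim (saturated (u ++ false ∷ []) [] (trans w≡ (sym (Lₚ.++-assoc u _ _)))
    (subst LucasL (sym (Lₚ.++-assoc u (false ∷ []) _))
      (FibL-replace u (subst FibL w≡ fib) ((λ ()) , tt) ,
       λ (h , _) → case trans (sym h) (trans (headL-++-∷ u _ _) (trans (cong headL (sym w≡)) headw≡)) of λ ())))

locally⇒saturatedL : ∀ {w} → LocallySaturated w → SaturatedL w
locally⇒saturatedL {w} local a b w≡ (fib , ¬ends) with FibL-around-1 a b fib
... | lasta≡false , headb≡false = cases (lastL≡false a lasta≡false) (headL≡false b headb≡false)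
  where
  open LocallySaturated local
  cases : (a ≡ [] ⊎ ∃ λ a′ → a ≡ a′ ++ false ∷ []) → (b ≡ [] ⊎ ∃ λ b′ → b ≡ false ∷ b′) → ⊥
  cases (inj₁ refl) (inj₁ refl) = ¬ends (refl , refl)
  cases (inj₂ (a′ , refl)) (inj₂ (b′ , refl)) = no000 a′ b′ (trans w≡ (Lₚ.++-assoc a′ _ _))
  cases (inj₁ refl) (inj₂ (b′ , refl)) =
    ¬ends (refl , trans (sym (cong lastL w≡)) (00-prefix b′ w≡))
  cases (inj₂ (a′ , refl)) (inj₁ refl) =
    ¬ends (trans (cong headL (Lₚ.++-assoc a′ (false ∷ []) (true ∷ [])))
             (trans (headL-++-∷ a′ _ _) (trans (sym (cong headL w≡′)) (00-suffix a′ w≡′))) ,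
      lastL-++-∷ (a′ ++ false ∷ []) true [])
    where
    w≡′ : w ≡ a′ ++ false ∷ false ∷ []
    w≡′ = trans w≡ (Lₚ.++-assoc a′ _ _)

-- Saturated Lucas strings and their gaps

private
  variable
    q : ℕ

init-last⇒All : ∀ {P : ℕ → Set} (ms : Vec ℕ (suc q)) → All P (init ms) → P (last ms) → All P ms
init-last⇒All (m ∷ []) [] Pm = Pm ∷ []
init-last⇒All (m ∷ m′ ∷ ms) (Pm ∷ Pinit) Plast = Pm ∷ init-last⇒All (m′ ∷ ms) Pinit Plast

All⇒init : ∀ {P : ℕ → Set} (ms : Vec ℕ (suc q)) → All P ms → All P (init ms)
All⇒init (m ∷ []) _ = []
All⇒init (m ∷ m′ ∷ ms) (Pm ∷ Pms) = Pm ∷ All⇒init (m′ ∷ ms) Pms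

All⇒last : ∀ {P : ℕ → Set} (ms : Vec ℕ (suc q)) → All P ms → P (last ms)
All⇒last (m ∷ []) (Pm ∷ []) = Pm
All⇒last (m ∷ m′ ∷ ms) (_ ∷ Pms) = All⇒last (m′ ∷ ms) Pms

FibL-topString⁻ : ∀ l (ms : Vec ℕ (suc q)) → FibL (topString (l ∷ ms)) → All (1 ≤_) (init ms)
FibL-topString⁻ l (m ∷ []) _ = []
FibL-topString⁻ l (zero ∷ m′ ∷ ms) fib with FibL-++⁻ʳ (0^ l) fib
... | ¬11 , _ = ⊥-elim (¬11 (refl , refl))
FibL-topString⁻ l (suc m ∷ m′ ∷ ms) fib =
  s≤s z≤n ∷ FibL-topString⁻ (suc m) (m′ ∷ ms) (FibL-tail true _ (FibL-++⁻ʳ (0^ l) fib))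

FibL-topString⁺ : ∀ l (ms : Vec ℕ (suc q)) → All (1 ≤_) (init ms) → FibL (topString (l ∷ ms))
FibL-topString⁺ l (zero ∷ []) _ = FibL-0^++ l tt
FibL-topString⁺ l (suc m ∷ []) _ = FibL-0^++ l ((λ ()) , FibL-0^++ (suc m) tt)
FibL-topString⁺ l (zero ∷ m′ ∷ ms) (() ∷ _)
FibL-topString⁺ l (suc m ∷ m′ ∷ ms) (_ ∷ positive) =
  FibL-0^++ l ((λ ()) , FibL-topString⁺ (suc m) (m′ ∷ ms) positive)

No000-++⁻ʳ : ∀ a {w} → No000 (a ++ w) → No000 w
No000-++⁻ʳ a no000 u v w≡ = no000 (a ++ u) v (trans (cong (a ++_) w≡) (sym (Lₚ.++-assoc a u _)))

No000-0^++⁻ : ∀ l {w} → No000 (0^ l ++ w) → l ≤ 2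
No000-0^++⁻ zero _ = z≤n
No000-0^++⁻ (suc zero) _ = s≤s z≤n
No000-0^++⁻ (suc (suc zero)) _ = s≤s (s≤s z≤n)
No000-0^++⁻ (suc (suc (suc l))) no000 = ⊥-elim (no000 [] (0^ l ++ _) refl)

No000-[] : No000 []
No000-[] [] _ ()
No000-[] (_ ∷ _) _ ()

No000-1∷ : ∀ {w} → No000 w → No000 (true ∷ w)
No000-1∷ no000 [] _ ()
No000-1∷ no000 (_ ∷ u) v eq = no000 u v (Lₚ.∷-injectiveʳ eq)

No000-0^++ : ∀ l {w} → l ≤ 2 → (∀ w′ → w ≢ false ∷ w′) → No000 w → No000 (0^ l ++ w)
No000-0^++ zero _ _ no000 = no000
No000-0^++ (suc zero) _ opens _ [] v refl = opens _ refl
No000-0^++ (suc (suc zero)) _ opens _ [] v refl = opens _ refl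
No000-0^++ (suc (suc (suc l))) (s≤s (s≤s ()))
No000-0^++ (suc l) l≤2 opens no000 (_ ∷ u) v eq =
  No000-0^++ l (≤-trans (n≤1+n l) l≤2) opens no000 u v (Lₚ.∷-injectiveʳ eq)

No000-topString⁻ : ∀ l (ms : Vec ℕ q) → No000 (topString (l ∷ ms)) → All (_≤ 2) (l ∷ ms)
No000-topString⁻ l [] no000 = No000-0^++⁻ l no000 ∷ []
No000-topString⁻ l (m ∷ ms) no000 =
  No000-0^++⁻ l no000 ∷ No000-topString⁻ m ms (No000-++⁻ʳ (true ∷ []) (No000-++⁻ʳ (0^ l) no000))

No000-topString⁺ : ∀ l (ms : Vec ℕ q) → All (_≤ 2) (l ∷ ms) → No000 (topString (l ∷ ms))
No000-topString⁺ l [] (l≤2 ∷ []) = No000-0^++ l l≤2 (λ _ ()) No000-[]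
No000-topString⁺ l (m ∷ ms) (l≤2 ∷ short) = No000-0^++ l l≤2 (λ _ ()) (No000-1∷ (No000-topString⁺ m ms short))

0^-∷ʳ : ∀ k → 0^ suc (suc k) ≡ 0^ k ++ false ∷ false ∷ []
0^-∷ʳ zero = refl
0^-∷ʳ (suc k) = cong (false ∷_) (0^-∷ʳ k)

lastL-1∷0^ : ∀ m → lastL (true ∷ 0^ m) ≡ true → m ≡ 0
lastL-1∷0^ zero _ = refl
lastL-1∷0^ (suc m) eq = case trans (sym eq) (lastL-0^ m {true}) of λ ()
  where
  lastL-0^ : ∀ m {x} → lastL (x ∷ 0^ suc m) ≡ false
  lastL-0^ zero = refl
  lastL-0^ (suc m) = lastL-0^ m {false}

topString-last : ∀ l (ms : Vec ℕ (suc q)) → ∃ λ Z → topString (l ∷ ms) ≡ Z ++ true ∷ 0^ last ms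
topString-last l (m ∷ []) = 0^ l , cong (λ z → 0^ l ++ true ∷ z) (Lₚ.++-identityʳ (0^ m))
topString-last l (m ∷ m′ ∷ ms) with topString-last m (m′ ∷ ms)
... | Z , eq = 0^ l ++ true ∷ Z , trans (cong (λ z → 0^ l ++ true ∷ z) eq) (sym (Lₚ.++-assoc (0^ l) (true ∷ Z) _))

lastL-topString : ∀ l (ms : Vec ℕ (suc q)) → lastL (topString (l ∷ ms)) ≡ lastL (true ∷ 0^ last ms)
lastL-topString l ms with topString-last l ms
... | Z , eq = trans (cong lastL eq) (lastL-++-∷ Z true _)

headL-topString : ∀ l (ms : Vec ℕ (suc q)) → headL (topString (l ∷ ms)) ≡ true → l ≡ 0
headL-topString zero (m ∷ ms) _ = refl

headL-topString-0 : ∀ (ms : Vec ℕ (suc q)) → headL (topString (0 ∷ ms)) ≡ true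
headL-topString-0 (m ∷ ms) = refl

topString-00-prefix : ∀ l (ms : Vec ℕ (suc q)) {v} → topString (l ∷ ms) ≡ false ∷ false ∷ v → 2 ≤ l
topString-00-prefix (suc (suc l)) ms _ = s≤s (s≤s z≤n)
topString-00-prefix zero (m ∷ ms) ()
topString-00-prefix (suc zero) (m ∷ ms) ()

topString-00-suffix : ∀ l (ms : Vec ℕ (suc q)) {u} →
  topString (l ∷ ms) ≡ u ++ false ∷ false ∷ [] → 2 ≤ last ms
topString-00-suffix l ms {u} eq with topString-last l ms
... | Z , eq′ = ends-00 (last ms) (trans (sym eq′) eq)
  where
  ends-00 : ∀ m → Z ++ true ∷ 0^ m ≡ u ++ false ∷ false ∷ [] → 2 ≤ m
  ends-00 zero eq = case trans (sym (lastL-++-∷ Z true [])) (trans (cong lastL eq) (lastL-++-∷ u false _)) of λ ()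
  ends-00 (suc zero) eq with Lₚ.∷ʳ-injective (Z ++ true ∷ []) (u ++ false ∷ [])
    (trans (Lₚ.++-assoc Z _ _) (trans eq (sym (Lₚ.++-assoc u _ _))))
  ... | Z1≡u0 , _ with Lₚ.∷ʳ-injective Z u Z1≡u0
  ...   | _ , ()
  ends-00 (suc (suc m)) _ = s≤s (s≤s z≤n)

topString-00-suffix⁺ : ∀ l (ms : Vec ℕ (suc q)) → 2 ≤ last ms →
  ∃ λ u → topString (l ∷ ms) ≡ u ++ false ∷ false ∷ []
topString-00-suffix⁺ l ms lp≥2 with last ms | topString-last l ms
topString-00-suffix⁺ l ms (s≤s (s≤s _)) | suc (suc k) | Z , eq =
  Z ++ true ∷ 0^ k , trans eq (trans (cong (λ z → Z ++ true ∷ z) (0^-∷ʳ k)) (sym (Lₚ.++-assoc Z (true ∷ 0^ k) _)))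

2≤m⇒m+n≤2⇒n≡0 : ∀ {m n} → 2 ≤ m → m + n ≤ 2 → n ≡ 0
2≤m⇒m+n≤2⇒n≡0 {n = zero} _ _ = refl
2≤m⇒m+n≤2⇒n≡0 {suc (suc m)} {suc n} (s≤s (s≤s _)) (s≤s (s≤s m+n≤0)) =
  case ≤-trans (m≤n+m (suc n) m) m+n≤0 of λ ()

m+n≤2 : ∀ {m n} → m ≤ 2 → n ≤ 2 → (2 ≤ m → n ≡ 0) → (2 ≤ n → m ≡ 0) → m + n ≤ 2
m+n≤2 {zero} _ n≤2 _ _ = n≤2
m+n≤2 {suc zero} {zero} _ _ _ _ = s≤s z≤n
m+n≤2 {suc zero} {suc zero} _ _ _ _ = s≤s (s≤s z≤n)
m+n≤2 {suc zero} {suc (suc n)} _ _ _ 2≤n⇒m≡0 = case 2≤n⇒m≡0 (s≤s (s≤s z≤n)) of λ ()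
m+n≤2 {suc (suc zero)} {zero} _ _ _ _ = s≤s (s≤s z≤n)
m+n≤2 {suc (suc zero)} {suc n} _ _ 2≤m⇒n≡0 _ = case 2≤m⇒n≡0 (s≤s (s≤s z≤n)) of λ ()
m+n≤2 {suc (suc (suc m))} (s≤s (s≤s ()))

¬both-zero⇒1≤m+n : ∀ {m n} → ¬ (m ≡ 0 × n ≡ 0) → 1 ≤ m + n
¬both-zero⇒1≤m+n {suc m} _ = s≤s z≤n
¬both-zero⇒1≤m+n {zero} {suc n} _ = s≤s z≤n
¬both-zero⇒1≤m+n {zero} {zero} ¬both = ⊥-elim (¬both (refl , refl))

-- l + last ms is the gap that wraps around the cyclic string.
WellSpaced : ℕ → Vec ℕ (suc q) → Set
WellSpaced l ms = (1 ≤ l + last ms × l + last ms ≤ 2) × All (λ m → 1 ≤ m × m ≤ 2) (init ms)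

saturated⇒WellSpaced : ∀ l (ms : Vec ℕ (suc q)) →
  LucasL (topString (l ∷ ms)) → SaturatedL (topString (l ∷ ms)) → WellSpaced l ms
saturated⇒WellSpaced l ms lucas@(fib , ¬ends) saturated =
  (¬both-zero⇒1≤m+n (λ (l≡0 , lp≡0) → ¬ends (headL≡true l≡0 , lastL≡true lp≡0)) ,
   m+n≤2 l≤2 (All⇒last ms ms≤2) l≥2⇒lp≡0 lp≥2⇒l≡0) ,
  All.zip (FibL-topString⁻ l ms fib , All⇒init ms ms≤2)
  where
  open LocallySaturated (saturatedL⇒locally lucas saturated)
  headL≡true : l ≡ 0 → headL (topString (l ∷ ms)) ≡ true
  headL≡true refl = headL-topString-0 ms
  lastL≡true : last ms ≡ 0 → lastL (topString (l ∷ ms)) ≡ true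
  lastL≡true lp≡0 = trans (lastL-topString l ms) (cong (λ m → lastL (true ∷ 0^ m)) lp≡0)
  l≤2 : l ≤ 2
  l≤2 = All.head (No000-topString⁻ l ms no000)
  ms≤2 : All (_≤ 2) ms
  ms≤2 = All.tail (No000-topString⁻ l ms no000)
  l≥2⇒lp≡0 : 2 ≤ l → last ms ≡ 0
  l≥2⇒lp≡0 (s≤s (s≤s _)) = lastL-1∷0^ (last ms) (trans (sym (lastL-topString l ms)) (00-prefix _ refl))
  lp≥2⇒l≡0 : 2 ≤ last ms → l ≡ 0
  lp≥2⇒l≡0 lp≥2 with topString-00-suffix⁺ l ms lp≥2
  ... | u , eq = headL-topString l ms (00-suffix u eq)

WellSpaced⇒saturated : ∀ l (ms : Vec ℕ (suc q)) → WellSpaced l ms →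
  LucasL (topString (l ∷ ms)) × SaturatedL (topString (l ∷ ms))
WellSpaced⇒saturated l ms ((wraps , l+lp≤2) , interior) =
  (FibL-topString⁺ l ms (proj₁ (All.unzip interior)) , ¬ends) ,
  locally⇒saturatedL (record { no000 = no000 ; 00-prefix = 00-prefix ; 00-suffix = 00-suffix })
  where
  lastL≡true⇒lp≡0 : lastL (topString (l ∷ ms)) ≡ true → last ms ≡ 0
  lastL≡true⇒lp≡0 eq = lastL-1∷0^ (last ms) (trans (sym (lastL-topString l ms)) eq)
  ¬ends : ¬ (headL (topString (l ∷ ms)) ≡ true × lastL (topString (l ∷ ms)) ≡ true)
  ¬ends (h , lt) with headL-topString l ms h | lastL≡true⇒lp≡0 lt
  ... | refl | lp≡0 = case subst (λ m → 1 ≤ m) lp≡0 wraps of λ ()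
  no000 : No000 (topString (l ∷ ms))
  no000 = No000-topString⁺ l ms (≤-trans (m≤m+n l _) l+lp≤2 ∷
    init-last⇒All ms (proj₂ (All.unzip interior)) (≤-trans (m≤n+m _ l) l+lp≤2))
  00-prefix : ∀ v → topString (l ∷ ms) ≡ false ∷ false ∷ v → lastL (topString (l ∷ ms)) ≡ true
  00-prefix v eq = trans (lastL-topString l ms)
    (cong (λ m → lastL (true ∷ 0^ m)) (2≤m⇒m+n≤2⇒n≡0 (topString-00-prefix l ms eq) l+lp≤2))
  00-suffix : ∀ u → topString (l ∷ ms) ≡ u ++ false ∷ false ∷ [] → headL (topString (l ∷ ms)) ≡ true
  00-suffix u eq with 2≤m⇒m+n≤2⇒n≡0 (topString-00-suffix l ms eq) (subst (_≤ 2) (+-comm l _) l+lp≤2)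
  ... | refl = headL-topString-0 ms

interior⇒All-init : ∀ {P : ℕ → Set} l (ms : Vec ℕ (suc q)) →
  (∀ (i : Fin (suc (suc q))) → 1 ≤ toℕ i → toℕ i < suc q → P (lookup (l ∷ ms) i)) → All P (init ms)
interior⇒All-init l (m ∷ []) _ = []
interior⇒All-init l (m ∷ m′ ∷ ms) P-interior =
  P-interior (Fin.suc Fin.zero) (s≤s z≤n) (s≤s (s≤s z≤n)) ∷
  interior⇒All-init m (m′ ∷ ms) λ
    { Fin.zero ()
    ; (Fin.suc i) _ (s≤s i<q) → P-interior (Fin.suc (Fin.suc i)) (s≤s z≤n) (s≤s (s≤s i<q)) }

All-init⇒interior : ∀ {P : ℕ → Set} l (ms : Vec ℕ (suc q)) → All P (init ms) →
  ∀ (i : Fin (suc (suc q))) → 1 ≤ toℕ i → toℕ i < suc q → P (lookup (l ∷ ms) i)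
All-init⇒interior l (m ∷ []) [] (Fin.suc Fin.zero) _ (s≤s ())
All-init⇒interior l (m ∷ m′ ∷ ms) (Pm ∷ _) (Fin.suc Fin.zero) _ _ = Pm
All-init⇒interior l (m ∷ m′ ∷ ms) (_ ∷ Pinit) (Fin.suc (Fin.suc i)) _ (s≤s i<) =
  All-init⇒interior m (m′ ∷ ms) Pinit (Fin.suc i) (s≤s z≤n) i<

GoodGaps⇒WellSpaced : ∀ l (ms : Vec ℕ (suc q)) → GoodGaps n (suc q) (l ∷ ms) → WellSpaced l ms
GoodGaps⇒WellSpaced {q = q} l ms (_ , _ , _ , wraps , l+lp≤2 , interior) =
  (subst (λ m → 1 ≤ l + m) lp≡ wraps , subst (λ m → l + m ≤ 2) lp≡ l+lp≤2) ,
  interior⇒All-init l ms interior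
  where
  lp≡ : lookup ms (fromℕ q) ≡ last ms
  lp≡ = sym (last≡lookup-fromℕ ms)

WellSpaced⇒GoodGaps : ∀ l (ms : Vec ℕ (suc q)) → sumV (l ∷ ms) ≡ n ∸ suc q → WellSpaced l ms →
  GoodGaps n (suc q) (l ∷ ms)
WellSpaced⇒GoodGaps {q = q} l ms sum≡ ((wraps , l+lp≤2) , interior) =
  sum≡ , ≤-trans (m≤m+n l _) l+lp≤2 , subst (_≤ 2) lp≡ (≤-trans (m≤n+m _ l) l+lp≤2) ,
  subst (λ m → 1 ≤ l + m) lp≡ wraps , subst (λ m → l + m ≤ 2) lp≡ l+lp≤2 , All-init⇒interior l ms interior
  where
  lp≡ : last ms ≡ lookup ms (fromℕ q)
  lp≡ = last≡lookup-fromℕ ms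

length-topString : ∀ l (ms : Vec ℕ q) → L.length (topString (l ∷ ms)) ≡ sumV (l ∷ ms) + q
length-topString l [] = trans (cong L.length (Lₚ.++-identityʳ (0^ l)))
  (trans (Lₚ.length-replicate l) (sym (trans (+-identityʳ (l + 0)) (+-identityʳ l))))
length-topString {suc q} l (m ∷ ms) = begin
  L.length (0^ l ++ true ∷ topString (m ∷ ms))    ≡⟨ Lₚ.length-++ (0^ l) ⟩
  L.length (0^ l) + suc (L.length (topString (m ∷ ms)))  ≡⟨ cong₂ (λ a b → a + suc b) (Lₚ.length-replicate l) (length-topString m ms) ⟩
  l + suc (sumV (m ∷ ms) + q)                      ≡⟨ +-suc l _ ⟩
  suc (l + (sumV (m ∷ ms) + q))                    ≡⟨ cong suc (+-assoc l _ q) ⟨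
  suc (sumV (l ∷ m ∷ ms) + q)                      ≡⟨ +-suc _ q ⟨
  sumV (l ∷ m ∷ ms) + suc q                        ∎
  where open ≡-Reasoning

gaps : ∀ (t : Word n) → Σ (Vec ℕ (suc (weight t))) λ ls → topString ls ≡ toList t
gaps [] = 0 ∷ [] , refl
gaps (false ∷ t) with gaps t
... | l ∷ ls , eq = suc l ∷ ls , cong (false ∷_) eq
gaps (true ∷ t) with gaps t
... | l ∷ ls , eq = 0 ∷ l ∷ ls , cong (true ∷_) eq

weight-topString : ∀ (t : Word n) (ls : Vec ℕ (suc p)) → toList t ≡ topString ls → weight t ≡ p
weight-topString [] (zero ∷ []) _ = refl
weight-topString (false ∷ t) (suc l ∷ ls) eq = weight-topString t (l ∷ ls) (Lₚ.∷-injectiveʳ eq)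
weight-topString (true ∷ t) (zero ∷ m ∷ ms) eq = cong suc (weight-topString t (m ∷ ms) (Lₚ.∷-injectiveʳ eq))
weight-topString [] (zero ∷ m ∷ ms) ()
weight-topString [] (suc l ∷ ls) ()
weight-topString (false ∷ t) (zero ∷ []) ()
weight-topString (false ∷ t) (zero ∷ m ∷ ms) ()
weight-topString (true ∷ t) (zero ∷ []) ()
weight-topString (true ∷ t) (suc l ∷ ls) ()

saturated⇒GoodGaps : ∀ (t : Word n) → weight t ≡ suc q → Lucas t → Saturated t →
  Σ (Vec ℕ (suc (suc q))) λ ls → GoodGaps n (suc q) ls × toList t ≡ topString ls
saturated⇒GoodGaps {n} {q} t weight≡ lucas saturated
  with subst (λ p → Σ (Vec ℕ (suc p)) λ ls → topString ls ≡ toList t) weight≡ (gaps t)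
... | l ∷ ms , t≡ = l ∷ ms , WellSpaced⇒GoodGaps {n = n} l ms sum≡ gapsOK , sym t≡
  where
  gapsOK : WellSpaced l ms
  gapsOK = saturated⇒WellSpaced l ms (subst LucasL (sym t≡) (Lucas⇒LucasL t lucas))
    (subst SaturatedL (sym t≡) (Saturated⇒SaturatedL t saturated))
  sum≡ : sumV (l ∷ ms) ≡ n ∸ suc q
  sum≡ = sym (trans (cong (_∸ suc q) length-t) (m+n∸n≡m _ (suc q)))
    where
    length-t : n ≡ sumV (l ∷ ms) + suc q
    length-t = trans (sym (length-toList t)) (trans (cong L.length (sym t≡)) (length-topString l ms))

GoodGaps⇒saturated : ∀ (ls : Vec ℕ (suc (suc q))) → GoodGaps n (suc q) ls → (t : Word n) → toList t ≡ topString ls →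
  Lucas t × Saturated t × weight t ≡ suc q
GoodGaps⇒saturated {n = n} (l ∷ ms) good t t≡ =
  LucasL⇒Lucas t (subst LucasL (sym t≡) (proj₁ saturatedL)) ,
  SaturatedL⇒Saturated t (subst SaturatedL (sym t≡) (proj₂ saturatedL)) ,
  weight-topString t (l ∷ ms) t≡
  where
  saturatedL : LucasL (topString (l ∷ ms)) × SaturatedL (topString (l ∷ ms))
  saturatedL = WellSpaced⇒saturated l ms (GoodGaps⇒WellSpaced {n = n} l ms good)

saturated⇒maximal-hypercube : ∀ (t : Word n) → weight t ≡ p → Lucas t → Saturated t →
  Σ (Word p → Word n) λ f → IsHypercube n p f × IsMaximal n p f × IsTop f t
saturated⇒maximal-hypercube t refl lucas saturated with support t
... | σ , dσ , cube≡t
  with saturated⇒maximal-cube σ dσ (subst Lucas (sym cube≡t) lucas) (subst Saturated (sym cube≡t) saturated)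
...   | hypercube , maximal , top = cube σ , hypercube , maximal , subst (IsTop (cube σ)) cube≡t top

maximal-hypercube-vertices : ∀ {f : Word p → Word n} → IsHypercube n p f → IsMaximal n p f →
  IsBottom f (zeros n) × Σ (Word n) λ t → IsTop f t × Lucas t × Saturated t × weight t ≡ p
maximal-hypercube-vertices {p = p} {f = f} hypercube@(lucas , _) maximal with maximal⇒cube-through-zero hypercube maximal
... | σ , dσ , b , f≡ =
  zeros-bottom (b , trans (f≡ b) (trans (cong (cube σ) (⊕-self b)) (cube-zeros σ))) ,
  cube σ (ones p) , top ,
  subst Lucas (proj₂ (proj₁ top)) (lucas _) ,
  maximal⇒top-saturated hypercube maximal dσ f≡ ,
  trans (weight-cube σ dσ (ones p)) (weight-ones p)
  where
  top : IsTop f (cube σ (ones p))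
  top = cube-top dσ f≡

proposition8 : (n p : ℕ) → 1 ≤ n → 1 ≤ p →
    ((f : Word p → Word n) → IsHypercube n p f → IsMaximal n p f →
      IsBottom f (zeros n) ×
      Σ (Word n) (λ t → IsTop f t ×
        Σ (Vec ℕ (suc p)) (λ ls → GoodGaps n p ls × toList t ≡ topString ls)))
    ×
    ((ls : Vec ℕ (suc p)) → GoodGaps n p ls → (t : Word n) → toList t ≡ topString ls →
      Σ (Word p → Word n) (λ f → IsHypercube n p f × IsMaximal n p f × IsTop f t))
proposition8 n (suc q) _ (s≤s z≤n) =
  (λ f hypercube maximal →
    let bottom , t , top , lucas , saturated , weight≡ = maximal-hypercube-vertices hypercube maximal
    in bottom , t , top , saturated⇒GoodGaps t weight≡ lucas saturated) ,
  (λ ls good t t≡ →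
    let lucas , saturated , weight≡ = GoodGaps⇒saturated ls good t t≡
    in saturated⇒maximal-hypercube t weight≡ lucas saturated)
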